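{- Two words $w_1$ and $w_2$ over $\mathcal{G}$ (vertices of $\Gamma$) belong to the same connected component of $\Gamma$ if and only if $Q(w_1)=Q(w_2)$.
   Context: Let $\mathcal{G}=\{1,2,3,0,\bar3,\bar2,\bar1\}$, totally ordered by $1\prec2\prec3\prec0\prec\bar3\prec\bar2\prec\bar1$. $B(\Lambda_1)$ is the $U_q(G_2)$-crystal with vertices $\mathcal{G}$ and arrows $1\xrightarrow{1}2\xrightarrow{2}3\xrightarrow{1}0\xrightarrow{1}\bar3\xrightarrow{2}\bar2\xrightarrow{1}\bar1$ ($a\xrightarrow{i}b$ means $\tilde f_ia=b$, $\tilde e_ib=a$; other applications give $0$); $\varepsilon_i(u)=\max\{k:\tilde e_i^ku\ne0\}$, $\varphi_i(u)=\max\{k:\tilde f_i^ku\ne0\}$. Words over $\mathcal{G}$ are identified with vertices of the crystal $\Gamma=\bigoplus_{l\ge0}B(\Lambda_1)^{\otimes l}$, with $\tilde f_i(u\otimes v)=\tilde f_iu\otimes v$ if $\varphi_i(u)>\varepsilon_i(v)$, else $u\otimes\tilde f_iv$; $\tilde e_i(u\otimes v)=u\otimes\tilde e_iv$ if $\varphi_i(u)<\varepsilon_i(v)$, else $\tilde e_iu\otimes v$. $B(w)$ is the connected component containing $w$; $w_1\sim w_2$ means there is a crystal isomorphism $B(w_1)\to B(w_2)$ sending $w_1$ to $w_2$. Tableaux of type $G_2$: $\mathrm{dist}(a,b)$ is the number of arrows between $a$ and $b$ in the chain above. A column is a box $[a]$ or two boxes with top $a$, bottom $b$, $a\prec b$ or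 $a=b=0$; reading $\mathrm{w}(C)$ top to bottom. Height-1 columns are admissible; a height-2 column $(a,b)$ is admissible if $\mathrm{dist}(a,b)\le2$ for $a\in\{1,0\}$ and $\le3$ otherwise. For admissible columns, $C_1\preceq C_2$ means: (i) $[a],[b]$ with $a\preceq b$, $(a,b)\ne(0,0)$; or (ii) $C_1=(a,b)$, $C_2=[c]$ with $a\preceq c$, $(a,c)\ne(0,0)$; or (iii) $C_1=(a,b)$, $C_2=(c,d)$ with $a\preceq c$, $(a,c)\neq(0,0)$, $b\preceq d$, $(b,d)\ne(0,0)$, and $\mathrm{dist}(a,d)\ge3$ if $a\in\{2,3,0\}$, $\mathrm{dist}(a,d)\ge2$ if $a=\bar3$. For $\lambda=\lambda_1\Lambda_1+\lambda_2\Lambda_2$, $Y(\lambda)$ has $\lambda_2$ columns of height 2 followed by $\lambda_1$ columns of height 1; a tableau of type $G_2$ of shape $\lambda$ is a filling $T=C_1\cdots C_s$ of $Y(\lambda)$ with admissible columns and $C_i\preceq C_{i+1}$; reading $\mathrm{w}(T)=\mathrm{w}(C_s)\cdots\mathrm{w}(C_1)$; its shape is $Y(\lambda)$. By Kang–Misra, for every word $w$ there is a unique tableau of type $G_2$, $P(w)$, with $w\sim\mathrm{w}(P(w))$. For a word $w=x_1\cdots x_l$, $Q(w)=(Q_1,\dots,Q_l)$ where $Q_i$ is the shape of $P(x_1\cdots x_i)$. -}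

module Defs where

open import Data.Nat using (ℕ; zero; suc; _+_; _∸_; _<ᵇ_; _≤_; _<_; _≥_)
open import Data.Bool using (Bool; true; false; if_then_else_)
open import Data.List using (List; []; _∷_; _++_; map; length; take; replicate; concatMap; reverse)
open import Data.List.Relation.Unary.All using (All)
open import Data.List.Relation.Unary.Linked using (Linked)
open import Data.Maybe using (Maybe; just; nothing) renaming (map to mapMaybe)
open import Data.Product using (Σ; _×_; _,_; ∃)
open import Data.Sum using (_⊎_)
open import Data.Empty using (⊥)
open import Data.Unit using (⊤)
open import Relation.Binary.PropositionalEquality using (_≡_; _≢_)
open import Relation.Nullary using (¬_)

data G : Set where
  g1 g2 g3 g0 g3b g2b g1b : G

rank : G → ℕ
rank g1  = 0
rank g2  = 1
rank g3  = 2
rank g0  = 3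
rank g3b = 4
rank g2b = 5
rank g1b = 6

_≺_ : G → G → Set
a ≺ b = rank a < rank b

_≼_ : G → G → Set
a ≼ b = rank a ≤ rank b

dist : G → G → ℕ
dist a b = (rank a ∸ rank b) + (rank b ∸ rank a)

-- The crystal B(Λ₁) of type G₂

data I : Set where
  i1 i2 : I

fL : I → G → Maybe G
fL i1 g1  = just g2
fL i1 g3  = just g0
fL i1 g0  = just g3b
fL i1 g2b = just g1b
fL i2 g2  = just g3
fL i2 g3b = just g2b
fL _  _   = nothing

eL : I → G → Maybe G
eL i1 g2  = just g1
eL i1 g0  = just g3
eL i1 g3b = just g0
eL i1 g1b = just g2b
eL i2 g3  = just g2
eL i2 g2b = just g3b
eL _  _   = nothing

-- ε_i, φ_i on letters (values of max{k : ẽ_i^k u ≠ 0}, max{k : f̃_i^k u ≠ 0})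
εL : I → G → ℕ
εL i1 g2  = 1
εL i1 g0  = 1
εL i1 g3b = 2
εL i1 g1b = 1
εL i2 g3  = 1
εL i2 g2b = 1
εL _  _   = 0

φL : I → G → ℕ
φL i1 g1  = 1
φL i1 g3  = 2
φL i1 g0  = 1
φL i1 g2b = 1
φL i2 g2  = 1
φL i2 g3b = 1
φL _  _   = 0

-- Words = vertices of Γ = ⊕_l B(Λ₁)^{⊗l};  x₁x₂…x_l = x₁ ⊗ (x₂ ⊗ (… ⊗ x_l))

Word : Set
Word = List G

-- ε_i and φ_i on words, via the tensor product rule
ε : I → Word → ℕ
φ : I → Word → ℕ
ε i []      = 0
ε i (x ∷ v) = εL i x + (ε i v ∸ φL i x)
φ i []      = 0
φ i (x ∷ v) = φ i v + (φL i x ∸ ε i v)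

f : I → Word → Maybe Word
f i []      = nothing
f i (x ∷ v) =
  if ε i v <ᵇ φL i x then mapMaybe (_∷ v) (fL i x) else mapMaybe (x ∷_) (f i v)

e : I → Word → Maybe Word
e i []      = nothing
e i (x ∷ v) =
  if φL i x <ᵇ ε i v then mapMaybe (x ∷_) (e i v) else mapMaybe (_∷ v) (eL i x)

data Conn (u : Word) : Word → Set where
  here  : Conn u u
  stepf : ∀ {v v'} (i : I) → Conn u v → f i v ≡ just v' → Conn u v'
  stepe : ∀ {v v'} (i : I) → Conn u v → e i v ≡ just v' → Conn u v'

-- w₁ ∼ w₂ : a crystal isomorphism B(w₁) → B(w₂) sending w₁ to w₂
-- (a bijection commuting with ẽ_i, f̃_i and preserving ε_i, φ_i;
--  the weight is then preserved since ⟨h_i, wt⟩ = φ_i − ε_i)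
record CrystalIso (w₁ w₂ : Word) : Set where
  field
    ψ        : Word → Word
    ψ-base   : ψ w₁ ≡ w₂
    ψ-into   : ∀ u → Conn w₁ u → Conn w₂ (ψ u)
    ψ-inj    : ∀ u v → Conn w₁ u → Conn w₁ v → ψ u ≡ ψ v → u ≡ v
    ψ-surj   : ∀ v → Conn w₂ v → ∃ λ u → Conn w₁ u × ψ u ≡ v
    ψ-f      : ∀ u → Conn w₁ u → ∀ i → mapMaybe ψ (f i u) ≡ f i (ψ u)
    ψ-e      : ∀ u → Conn w₁ u → ∀ i → mapMaybe ψ (e i u) ≡ e i (ψ u)
    ψ-ε      : ∀ u → Conn w₁ u → ∀ i → ε i (ψ u) ≡ ε i u
    ψ-φ      : ∀ u → Conn w₁ u → ∀ i → φ i (ψ u) ≡ φ i u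

_∼_ : Word → Word → Set
w₁ ∼ w₂ = CrystalIso w₁ w₂

data Col : Set where
  col1 : G → Col
  col2 : G → G → Col      -- top a, bottom b

wC : Col → Word
wC (col1 a)   = a ∷ []
wC (col2 a b) = a ∷ b ∷ []

is10 : G → Bool
is10 g1 = true
is10 g0 = true
is10 _  = false

Admissible : Col → Set
Admissible (col1 a)   = ⊤
Admissible (col2 a b) =
  (a ≺ b ⊎ (a ≡ g0 × b ≡ g0)) ×
  (if is10 a then dist a b ≤ 2 else dist a b ≤ 3)

NotBoth0 : G → G → Set
NotBoth0 a b = ¬ (a ≡ g0 × b ≡ g0)

DistCond : G → G → Set
DistCond g2  d = dist g2 d ≥ 3
DistCond g3  d = dist g3 d ≥ 3
DistCond g0  d = dist g0 d ≥ 3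
DistCond g3b d = dist g3b d ≥ 2
DistCond _   _ = ⊤

_⪯C_ : Col → Col → Set
col1 a   ⪯C col1 b   = a ≼ b × NotBoth0 a b
col2 a b ⪯C col1 c   = a ≼ c × NotBoth0 a c
col2 a b ⪯C col2 c d = a ≼ c × NotBoth0 a c × b ≼ d × NotBoth0 b d × DistCond a d
col1 _   ⪯C col2 _ _ = ⊥

-- λ = λ₁Λ₁ + λ₂Λ₂ represented as (λ₁ , λ₂)
Shape : Set
Shape = ℕ × ℕ

height : Col → ℕ
height (col1 _)   = 1
height (col2 _ _) = 2

FillsShape : Shape → List Col → Set
FillsShape (l1 , l2) cs = map height cs ≡ replicate l2 2 ++ replicate l1 1

IsTableau : Shape → List Col → Set
IsTableau sh cs = FillsShape sh cs × All Admissible cs × Linked _⪯C_ cs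

record Tableau : Set where
  constructor tab
  field
    shape : Shape
    cols  : List Col
    isTab : IsTableau shape cols

wT : Tableau → Word
wT T = concatMap wC (reverse (Tableau.cols T))

IsPFunction : (Word → Tableau) → Set
IsPFunction P = ∀ w → w ∼ wT (P w)

prefixes : Word → List Word
prefixes []      = []
prefixes (x ∷ w) = (x ∷ []) ∷ map (x ∷_) (prefixes w)

Q : (Word → Tableau) → Word → List Shape
Q P w = map (λ u → Tableau.shape (P u)) (prefixes w)

{-# OPTIONS --safe #-}

-- Every component B(w) has a unique highest weight vector h, and the shape of P(w) is (φ₁ h , φ₂ h):
-- tableau words of a given shape are closed under ẽᵢ and f̃ᵢ (a finite check on single columns and on
-- pairs of adjacent columns), the only highest weight one among them is the canonical tableau with
-- columns (1,2) and 1, whose φ-values are the shape, and w ∼ w(P(w)) transports this to B(w).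
-- By the tensor rule the operators act on x₁⋯xₗ either inside x₁⋯xₗ₋₁ or on xₗ, so the component of
-- x₁⋯xₗ consists of words u b with u in the component of x₁⋯xₗ₋₁; by induction Q is constant on
-- components. Conversely, if Q(w₁) = Q(w₂) then by induction the prefixes lie in one component, so the
-- highest weight vectors of B(w₁) and B(w₂) are h x and h y with the same h; having the same φ-values,
-- the letters x and y have the same weight, hence are equal.

module Submission where

open import Defs
open import Data.Nat using (ℕ; zero; suc; _+_; _∸_; _<ᵇ_; _≤_; _<_; _≤?_; _<?_; z≤n; s≤s; s≤s⁻¹)
open import Data.Nat.Properties
open import Data.Fin using (Fin)
open import Data.Fin.Patterns using (0F; 1F; 2F; 3F; 4F; 5F; 6F)
import Data.Fin.Properties as Fin
open import Data.Bool using (true; false; if_then_else_; T)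
open import Data.List using (List; []; _∷_; _++_; _∷ʳ_; map; replicate; reverse; concatMap)
open import Data.List.Properties using (++-identityʳ; concatMap-++; unfold-reverse; ∷-injective; ∷ʳ-injective; map-++)
open import Data.List.Relation.Unary.All using (All; []; _∷_)
import Data.List.Relation.Unary.All as All
open import Data.List.Reverse using (Reverse; []; _∶_∶ʳ_; reverseView)
open import Data.List.Relation.Unary.Linked using (Linked; [-]; _∷_)
import Data.List.Relation.Unary.Linked as Linked
open import Data.Maybe using (Maybe; just; nothing) renaming (map to mapMaybe)
import Data.Maybe.Properties as Maybe
import Data.List.Properties as List
import Data.Maybe.Relation.Unary.All as MaybeAll
import Data.Maybe.Relation.Unary.Any as MaybeAny
open import Data.Product using (Σ; _×_; _,_; ∃; ∃₂; proj₁; proj₂)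
open import Data.Sum using (_⊎_; inj₁; inj₂)
open import Data.Empty using (⊥-elim)
open import Data.Unit using (tt)
open import Relation.Binary.Definitions using (DecidableEquality)
open import Relation.Binary.PropositionalEquality using (_≡_; _≢_; refl; sym; trans; cong; cong₂; subst; subst₂; module ≡-Reasoning)
open import Relation.Nullary using (¬_; Dec; yes; no)
open import Relation.Nullary.Decidable using (_×-dec_; _⊎-dec_; _→-dec_; ¬?; map′; from-yes)

letter : Fin 7 → G
letter 0F = g1
letter 1F = g2
letter 2F = g3
letter 3F = g0
letter 4F = g3b
letter 5F = g2b
letter 6F = g1b

letterIndex : G → Fin 7
letterIndex g1  = 0F
letterIndex g2  = 1F
letterIndex g3  = 2F
letterIndex g0  = 3F
letterIndex g3b = 4F
letterIndex g2b = 5F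
letterIndex g1b = 6F

letter-index : ∀ a → letter (letterIndex a) ≡ a
letter-index g1  = refl
letter-index g2  = refl
letter-index g3  = refl
letter-index g0  = refl
letter-index g3b = refl
letter-index g2b = refl
letter-index g1b = refl

_≟G_ : DecidableEquality G
a ≟G b = map′ index-injective (cong letterIndex) (letterIndex a Fin.≟ letterIndex b)
  where
  index-injective : letterIndex a ≡ letterIndex b → a ≡ b
  index-injective eq = trans (sym (letter-index a)) (trans (cong letter eq) (letter-index b))

∀G? : {P : G → Set} → (∀ a → Dec (P a)) → Dec (∀ a → P a)
∀G? {P} P? = map′ (λ h a → subst P (letter-index a) (h (letterIndex a))) (λ h k → h (letter k))
  (Fin.all? (λ k → P? (letter k)))

∀I? : {P : I → Set} → (∀ i → Dec (P i)) → Dec (∀ i → P i)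
∀I? {P} P? = map′ both (λ h → h i1 , h i2) (P? i1 ×-dec P? i2)
  where
  both : P i1 × P i2 → ∀ i → P i
  both (p , _) i1 = p
  both (_ , q) i2 = q

∀Col? : {P : Col → Set} → (∀ C → Dec (P C)) → Dec (∀ C → P C)
∀Col? {P} P? = map′ every (λ h → (λ a → h (col1 a)) , (λ a b → h (col2 a b)))
  (∀G? (λ a → P? (col1 a)) ×-dec ∀G? (λ a → ∀G? (λ b → P? (col2 a b))))
  where
  every : (∀ a → P (col1 a)) × (∀ a b → P (col2 a b)) → ∀ C → P C
  every (h₁ , _) (col1 a)   = h₁ a
  every (_ , h₂) (col2 a b) = h₂ a b

∃G? : {P : G → Set} → (∀ a → Dec (P a)) → Dec (∃ P)
∃G? {P} P? = map′ (λ (k , p) → letter k , p) (λ (a , p) → letterIndex a , subst P (sym (letter-index a)) p)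
  (Fin.any? (λ k → P? (letter k)))

∃Col? : {P : Col → Set} → (∀ C → Dec (P C)) → Dec (∃ P)
∃Col? {P} P? = map′ some (λ { (col1 a , p) → inj₁ (a , p) ; (col2 a b , p) → inj₂ (a , b , p) })
  (∃G? (λ a → P? (col1 a)) ⊎-dec ∃G? (λ a → ∃G? (λ b → P? (col2 a b))))
  where
  some : (∃ λ a → P (col1 a)) ⊎ (∃₂ λ a b → P (col2 a b)) → ∃ P
  some (inj₁ (a , p))     = col1 a , p
  some (inj₂ (a , b , p)) = col2 a b , p

≺? : ∀ a b → Dec (a ≺ b)
≺? a b = rank a <? rank b

≼? : ∀ a b → Dec (a ≼ b)
≼? a b = rank a ≤? rank b

notBoth0? : ∀ a b → Dec (NotBoth0 a b)
notBoth0? a b = ¬? ((a ≟G g0) ×-dec (b ≟G g0))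

admissible? : ∀ C → Dec (Admissible C)
admissible? (col1 a)   = yes tt
admissible? (col2 a b) = (≺? a b ⊎-dec ((a ≟G g0) ×-dec (b ≟G g0))) ×-dec bound? (is10 a)
  where
  bound? : ∀ c → Dec (if c then dist a b ≤ 2 else dist a b ≤ 3)
  bound? true  = dist a b ≤? 2
  bound? false = dist a b ≤? 3

distCond? : ∀ a d → Dec (DistCond a d)
distCond? g1  d = yes tt
distCond? g2  d = 3 ≤? dist g2 d
distCond? g3  d = 3 ≤? dist g3 d
distCond? g0  d = 3 ≤? dist g0 d
distCond? g3b d = 2 ≤? dist g3b d
distCond? g2b d = yes tt
distCond? g1b d = yes tt

⪯C? : ∀ C D → Dec (C ⪯C D)
⪯C? (col1 a)   (col1 b)   = ≼? a b ×-dec notBoth0? a b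
⪯C? (col2 a b) (col1 c)   = ≼? a c ×-dec notBoth0? a c
⪯C? (col2 a b) (col2 c d) = ≼? a c ×-dec notBoth0? a c ×-dec ≼? b d ×-dec notBoth0? b d ×-dec distCond? a d
⪯C? (col1 _)   (col2 _ _) = no λ ()

_≟M_ : DecidableEquality (Maybe G)
_≟M_ = Maybe.≡-dec _≟G_

opaque
  fL-arrow : ∀ i x y → fL i x ≡ just y → eL i y ≡ just x × φL i x ≡ suc (φL i y) × εL i y ≡ suc (εL i x)
  fL-arrow = from-yes (∀I? λ i → ∀G? λ x → ∀G? λ y →
    (fL i x ≟M just y) →-dec ((eL i y ≟M just x) ×-dec (φL i x ≟ suc (φL i y)) ×-dec (εL i y ≟ suc (εL i x))))

  eL⇒fL : ∀ i x y → eL i x ≡ just y → fL i y ≡ just x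
  eL⇒fL = from-yes (∀I? λ i → ∀G? λ x → ∀G? λ y → (eL i x ≟M just y) →-dec (fL i y ≟M just x))

  eL≡nothing⇒εL≡0 : ∀ i x → eL i x ≡ nothing → εL i x ≡ 0
  eL≡nothing⇒εL≡0 = from-yes (∀I? λ i → ∀G? λ x → (eL i x ≟M nothing) →-dec (εL i x ≟ 0))

  εL≡0⇒eL≡nothing : ∀ i x → εL i x ≡ 0 → eL i x ≡ nothing
  εL≡0⇒eL≡nothing = from-yes (∀I? λ i → ∀G? λ x → (εL i x ≟ 0) →-dec (eL i x ≟M nothing))

  eL-rank : ∀ i x y → eL i x ≡ just y → rank x ≡ suc (rank y)
  eL-rank = from-yes (∀I? λ i → ∀G? λ x → ∀G? λ y → (eL i x ≟M just y) →-dec (rank x ≟ suc (rank y)))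

  weight-injective : ∀ x y → (∀ i → εL i x + φL i y ≡ εL i y + φL i x) → x ≡ y
  weight-injective = from-yes (∀G? λ x → ∀G? λ y → ∀I? (λ i → εL i x + φL i y ≟ εL i y + φL i x) →-dec (x ≟G y))

-- The tensor rule

∸-assoc-ε : ∀ a p b c → (a + (c ∸ b)) ∸ p ≡ (a ∸ p) + (c ∸ (b + (p ∸ a)))
∸-assoc-ε a       zero    b c rewrite 0∸n≡0 a | +-identityʳ b = refl
∸-assoc-ε zero    (suc p) b c = ∸-+-assoc c b (suc p)
∸-assoc-ε (suc a) (suc p) b c = ∸-assoc-ε a p b c

∸-assoc-φ : ∀ b c a p → (b ∸ c) + (p ∸ (a + (c ∸ b))) ≡ (b + (p ∸ a)) ∸ c
∸-assoc-φ b       zero    a p rewrite 0∸n≡0 b | +-identityʳ a = refl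
∸-assoc-φ zero    (suc c) a p = sym (∸-+-assoc p a (suc c))
∸-assoc-φ (suc b) (suc c) a p = ∸-assoc-φ b c a p

∸-swap-< : ∀ a p b c → a < p → c < b + (p ∸ a) → a + (c ∸ b) < p
∸-swap-< zero    (suc p) b c _         h rewrite +-suc b p = s≤s (m≤n+o⇒m∸n≤o c b (s≤s⁻¹ h))
∸-swap-< (suc a) (suc p) b c (s≤s a<p) h = s≤s (∸-swap-< a p b c a<p h)

∸-swap-≤ : ∀ a p b c → a ≤ p → c ≤ b + (p ∸ a) → a + (c ∸ b) ≤ p
∸-swap-≤ zero    p       b c _         h = m≤n+o⇒m∸n≤o c b h
∸-swap-≤ (suc a) (suc p) b c (s≤s a≤p) h = s≤s (∸-swap-≤ a p b c a≤p h)

∸-swap-≥ : ∀ a p b c → a ≤ p → b + (p ∸ a) ≤ c → p ≤ a + (c ∸ b)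
∸-swap-≥ zero    p       b c _         h = m+n≤o⇒m≤o∸n p (subst (_≤ c) (+-comm b p) h)
∸-swap-≥ (suc a) (suc p) b c (s≤s a≤p) h = s≤s (∸-swap-≥ a p b c a≤p h)

∸-swap-> : ∀ a p b c → a ≤ p → b + (p ∸ a) < c → p < a + (c ∸ b)
∸-swap-> zero    p       b c _         h = m+n≤o⇒m≤o∸n (suc p) (subst (_≤ c) (trans (sym (+-suc b p)) (+-comm b (suc p))) h)
∸-swap-> (suc a) (suc p) b c (s≤s a≤p) h = s≤s (∸-swap-> a p b c a≤p h)

<⇒<ᵇ≡true : ∀ {m n} → m < n → (m <ᵇ n) ≡ true
<⇒<ᵇ≡true {m} {n} m<n with m <ᵇ n | <⇒<ᵇ m<n
... | true | _ = refl

≥⇒<ᵇ≡false : ∀ {m n} → n ≤ m → (m <ᵇ n) ≡ false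
≥⇒<ᵇ≡false {m} {n} n≤m with m <ᵇ n in eq
... | true  = ⊥-elim (<⇒≱ (<ᵇ⇒< m n (subst T (sym eq) tt)) n≤m)
... | false = refl

ε-++ : ∀ i u v → ε i (u ++ v) ≡ ε i u + (ε i v ∸ φ i u)
ε-++ i []      v = refl
ε-++ i (x ∷ u) v rewrite ε-++ i u v | +-assoc (εL i x) (ε i u ∸ φL i x) (ε i v ∸ (φ i u + (φL i x ∸ ε i u))) =
  cong (εL i x +_) (∸-assoc-ε (ε i u) (φL i x) (φ i u) (ε i v))

φ-++ : ∀ i u v → φ i (u ++ v) ≡ φ i v + (φ i u ∸ ε i v)
φ-++ i []      v rewrite 0∸n≡0 (ε i v) | +-identityʳ (φ i v) = refl
φ-++ i (x ∷ u) v rewrite φ-++ i u v | ε-++ i u v | +-assoc (φ i v) (φ i u ∸ ε i v) (φL i x ∸ (ε i u + (ε i v ∸ φ i u))) =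
  cong (φ i v +_) (∸-assoc-φ (φ i u) (ε i v) (ε i u) (φL i x))

f-++ : ∀ i u v → f i (u ++ v) ≡ (if ε i v <ᵇ φ i u then mapMaybe (_++ v) (f i u) else mapMaybe (u ++_) (f i v))
f-++ i []      v rewrite ≥⇒<ᵇ≡false {ε i v} {0} z≤n = sym (Maybe.map-id (f i v))
f-++ i (x ∷ u) v rewrite ε-++ i u v | f-++ i u v with ε i u <? φL i x
... | yes εu<φx rewrite <⇒<ᵇ≡true εu<φx with ε i v <? φ i u + (φL i x ∸ ε i u)
...   | yes εv<φxu rewrite <⇒<ᵇ≡true εv<φxu | <⇒<ᵇ≡true (∸-swap-< (ε i u) (φL i x) (φ i u) (ε i v) εu<φx εv<φxu) =
        Maybe.map-∘ (fL i x)
...   | no εv≮φxu rewrite ≥⇒<ᵇ≡false (≮⇒≥ εv≮φxu)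
                        | ≥⇒<ᵇ≡false (∸-swap-≥ (ε i u) (φL i x) (φ i u) (ε i v) (<⇒≤ εu<φx) (≮⇒≥ εv≮φxu))
                        | ≥⇒<ᵇ≡false {ε i v} {φ i u} (≤-trans (m≤m+n (φ i u) _) (≮⇒≥ εv≮φxu)) =
        sym (Maybe.map-∘ (f i v))
f-++ i (x ∷ u) v | no εu≮φx rewrite ≥⇒<ᵇ≡false (≮⇒≥ εu≮φx)
                                  | ≥⇒<ᵇ≡false {ε i u + (ε i v ∸ φ i u)} {φL i x} (≤-trans (≮⇒≥ εu≮φx) (m≤m+n (ε i u) _))
                                  | m≤n⇒m∸n≡0 (≮⇒≥ εu≮φx) | +-identityʳ (φ i u) with ε i v <? φ i u
... | yes εv<φu rewrite <⇒<ᵇ≡true εv<φu = trans (sym (Maybe.map-∘ (f i u))) (Maybe.map-∘ (f i u))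
... | no εv≮φu rewrite ≥⇒<ᵇ≡false (≮⇒≥ εv≮φu) = sym (Maybe.map-∘ (f i v))

ε≡0⇒e≡nothing : ∀ i w → ε i w ≡ 0 → e i w ≡ nothing
ε≡0⇒e≡nothing i []      _ = refl
ε≡0⇒e≡nothing i (x ∷ v) h
  rewrite ≥⇒<ᵇ≡false {φL i x} {ε i v} (m∸n≡0⇒m≤n (m+n≡0⇒n≡0 (εL i x) h))
        | εL≡0⇒eL≡nothing i x (m+n≡0⇒m≡0 (εL i x) h) = refl

e-++ : ∀ i u v → e i (u ++ v) ≡ (if φ i u <ᵇ ε i v then mapMaybe (u ++_) (e i v) else mapMaybe (_++ v) (e i u))
e-++ i [] v with ε i v in εv
... | zero  = ε≡0⇒e≡nothing i v εv
... | suc _ = sym (Maybe.map-id (e i v))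
e-++ i (x ∷ u) v rewrite ε-++ i u v | e-++ i u v with φL i x <? ε i u
... | yes φx<εu rewrite <⇒<ᵇ≡true φx<εu | <⇒<ᵇ≡true {φL i x} {ε i u + (ε i v ∸ φ i u)} (≤-trans φx<εu (m≤m+n (ε i u) _))
                      | m≤n⇒m∸n≡0 (<⇒≤ φx<εu) | +-identityʳ (φ i u) with φ i u <? ε i v
...   | yes φu<εv rewrite <⇒<ᵇ≡true φu<εv = sym (Maybe.map-∘ (e i v))
...   | no φu≮εv rewrite ≥⇒<ᵇ≡false (≮⇒≥ φu≮εv) = trans (sym (Maybe.map-∘ (e i u))) (Maybe.map-∘ (e i u))
e-++ i (x ∷ u) v | no φx≮εu rewrite ≥⇒<ᵇ≡false (≮⇒≥ φx≮εu) with φ i u + (φL i x ∸ ε i u) <? ε i v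
... | yes φxu<εv rewrite <⇒<ᵇ≡true φxu<εv | <⇒<ᵇ≡true (∸-swap-> (ε i u) (φL i x) (φ i u) (ε i v) (≮⇒≥ φx≮εu) φxu<εv)
                       | <⇒<ᵇ≡true {φ i u} {ε i v} (≤-trans (s≤s (m≤m+n (φ i u) _)) φxu<εv) = sym (Maybe.map-∘ (e i v))
... | no φxu≮εv rewrite ≥⇒<ᵇ≡false (≮⇒≥ φxu≮εv)
                      | ≥⇒<ᵇ≡false (∸-swap-≤ (ε i u) (φL i x) (φ i u) (ε i v) (≮⇒≥ φx≮εu) (≮⇒≥ φxu≮εv)) =
        Maybe.map-∘ (eL i x)

if-map-just : ∀ {A B C : Set} b (g : A → C) (m : Maybe A) (h : B → C) (n : Maybe B) {w : C} →
  (if b then mapMaybe g m else mapMaybe h n) ≡ just w →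
  (b ≡ true × ∃ λ y → m ≡ just y × w ≡ g y) ⊎ (b ≡ false × ∃ λ y → n ≡ just y × w ≡ h y)
if-map-just true  g (just y) h n refl = inj₁ (refl , y , refl , refl)
if-map-just false g m h (just y) refl = inj₂ (refl , y , refl , refl)

<ᵇ≡true⇒< : ∀ {m n} → (m <ᵇ n) ≡ true → m < n
<ᵇ≡true⇒< {m} {n} eq = <ᵇ⇒< m n (subst T (sym eq) tt)

<ᵇ≡false⇒≥ : ∀ {m n} → (m <ᵇ n) ≡ false → n ≤ m
<ᵇ≡false⇒≥ eq = ≮⇒≥ (λ lt → subst T eq (<⇒<ᵇ lt))

f-∷-just : ∀ i x v {w} → f i (x ∷ v) ≡ just w →
  (ε i v < φL i x × ∃ λ y → fL i x ≡ just y × w ≡ y ∷ v) ⊎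
  (φL i x ≤ ε i v × ∃ λ v′ → f i v ≡ just v′ × w ≡ x ∷ v′)
f-∷-just i x v h with if-map-just (ε i v <ᵇ φL i x) (_∷ v) (fL i x) (x ∷_) (f i v) h
... | inj₁ (b , r) = inj₁ (<ᵇ≡true⇒< b , r)
... | inj₂ (b , r) = inj₂ (<ᵇ≡false⇒≥ b , r)

e-∷-just : ∀ i x v {w} → e i (x ∷ v) ≡ just w →
  (φL i x < ε i v × ∃ λ v′ → e i v ≡ just v′ × w ≡ x ∷ v′) ⊎
  (ε i v ≤ φL i x × ∃ λ y → eL i x ≡ just y × w ≡ y ∷ v)
e-∷-just i x v h with if-map-just (φL i x <ᵇ ε i v) (x ∷_) (e i v) (_∷ v) (eL i x) h
... | inj₁ (b , r) = inj₁ (<ᵇ≡true⇒< b , r)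
... | inj₂ (b , r) = inj₂ (<ᵇ≡false⇒≥ b , r)

eL-arrow : ∀ i x y → eL i x ≡ just y → fL i y ≡ just x × εL i x ≡ suc (εL i y) × φL i y ≡ suc (φL i x)
eL-arrow i x y ex with eL⇒fL i x y ex
... | fy with fL-arrow i y x fy
...   | _ , φy , εx = fy , εx , φy

f-ε : ∀ i w {w′} → f i w ≡ just w′ → ε i w′ ≡ suc (ε i w)
f-ε i (x ∷ v) h with f-∷-just i x v h
... | inj₁ (εv<φx , y , fx , refl) with fL-arrow i x y fx
...   | _ , φx , εy rewrite εy | m≤n⇒m∸n≡0 (<⇒≤ εv<φx) | m≤n⇒m∸n≡0 (s≤s⁻¹ (subst (ε i v <_) φx εv<φx)) = refl
f-ε i (x ∷ v) h | inj₂ (φx≤εv , v′ , fv , refl) rewrite f-ε i v fv | +-∸-assoc 1 φx≤εv = +-suc (εL i x) _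

e-ε : ∀ i w {w′} → e i w ≡ just w′ → ε i w ≡ suc (ε i w′)
e-ε i (x ∷ v) h with e-∷-just i x v h
... | inj₁ (φx<εv , v′ , ev , refl) rewrite e-ε i v ev | +-∸-assoc 1 (s≤s⁻¹ φx<εv) = +-suc (εL i x) _
... | inj₂ (εv≤φx , y , ex , refl) with eL-arrow i x y ex
...   | _ , εx , φy rewrite εx | φy | m≤n⇒m∸n≡0 εv≤φx | m≤n⇒m∸n≡0 (m≤n⇒m≤1+n εv≤φx) = refl

f⇒e : ∀ i w {w′} → f i w ≡ just w′ → e i w′ ≡ just w
f⇒e i (x ∷ v) h with f-∷-just i x v h
... | inj₁ (εv<φx , y , fx , refl) with fL-arrow i x y fx
...   | ey , φx , _ rewrite ≥⇒<ᵇ≡false {φL i y} {ε i v} (s≤s⁻¹ (subst (ε i v <_) φx εv<φx)) | ey = refl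
f⇒e i (x ∷ v) h | inj₂ (φx≤εv , v′ , fv , refl)
  rewrite <⇒<ᵇ≡true {φL i x} {ε i v′} (subst (φL i x <_) (sym (f-ε i v fv)) (s≤s φx≤εv)) | f⇒e i v fv = refl

e⇒f : ∀ i w {w′} → e i w ≡ just w′ → f i w′ ≡ just w
e⇒f i (x ∷ v) h with e-∷-just i x v h
... | inj₁ (φx<εv , v′ , ev , refl)
  rewrite ≥⇒<ᵇ≡false {ε i v′} {φL i x} (s≤s⁻¹ (subst (φL i x <_) (e-ε i v ev) φx<εv)) | e⇒f i v ev = refl
... | inj₂ (εv≤φx , y , ex , refl) with eL-arrow i x y ex
...   | fy , _ , φy rewrite <⇒<ᵇ≡true {ε i v} {φL i y} (subst (ε i v <_) (sym φy) (s≤s εv≤φx)) | fy = refl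

e≡nothing⇒ε≡0 : ∀ i w → e i w ≡ nothing → ε i w ≡ 0
e≡nothing⇒ε≡0 i []      _ = refl
e≡nothing⇒ε≡0 i (x ∷ v) h with φL i x <? ε i v
... | yes φx<εv rewrite <⇒<ᵇ≡true φx<εv with e i v in ev
...   | nothing = ⊥-elim (<⇒≱ φx<εv (subst (_≤ φL i x) (sym (e≡nothing⇒ε≡0 i v ev)) z≤n))
e≡nothing⇒ε≡0 i (x ∷ v) h | no φx≮εv rewrite ≥⇒<ᵇ≡false (≮⇒≥ φx≮εv) with eL i x in ex
... | nothing = cong₂ _+_ (eL≡nothing⇒εL≡0 i x ex) (m≤n⇒m∸n≡0 (≮⇒≥ φx≮εv))

rankSum : Word → ℕ
rankSum []      = 0
rankSum (x ∷ v) = rank x + rankSum v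

e-rankSum : ∀ i w {w′} → e i w ≡ just w′ → rankSum w ≡ suc (rankSum w′)
e-rankSum i (x ∷ v) h with e-∷-just i x v h
... | inj₁ (_ , v′ , ev , refl) rewrite e-rankSum i v ev = +-suc (rank x) _
... | inj₂ (_ , y , ex , refl) rewrite eL-rank i x y ex = refl

data Op : Set where
  raise lower : Op

op : Op → I → Word → Maybe Word
op raise = f
op lower = e

∀Op? : {P : Op → Set} → (∀ o → Dec (P o)) → Dec (∀ o → P o)
∀Op? {P} P? = map′ both (λ h → h raise , h lower) (P? raise ×-dec P? lower)
  where
  both : P raise × P lower → ∀ o → P o
  both (p , _) raise = p
  both (_ , q) lower = q

ActsLeft : Op → ℕ → ℕ → Set
ActsLeft raise φu εv = εv < φu
ActsLeft lower φu εv = εv ≤ φu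

actsLeft? : ∀ o φu εv → Dec (ActsLeft o φu εv)
actsLeft? raise φu εv = εv <? φu
actsLeft? lower φu εv = εv ≤? φu

ActsLeft-mono : ∀ o {φu φu′ εv} → φu ≤ φu′ → ActsLeft o φu εv → ActsLeft o φu′ εv
ActsLeft-mono raise le h = <-≤-trans h le
ActsLeft-mono lower le h = ≤-trans h le

¬ActsLeft⇒≤ : ∀ o {φu εv} → ¬ ActsLeft o φu εv → φu ≤ εv
¬ActsLeft⇒≤ raise h = ≮⇒≥ h
¬ActsLeft⇒≤ lower h = <⇒≤ (≰⇒> h)

op-++ˡ : ∀ o i u v → ActsLeft o (φ i u) (ε i v) → op o i (u ++ v) ≡ mapMaybe (_++ v) (op o i u)
op-++ˡ raise i u v h rewrite f-++ i u v | <⇒<ᵇ≡true h = refl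
op-++ˡ lower i u v h rewrite e-++ i u v | ≥⇒<ᵇ≡false h = refl

op-++ʳ : ∀ o i u v → ¬ ActsLeft o (φ i u) (ε i v) → op o i (u ++ v) ≡ mapMaybe (u ++_) (op o i v)
op-++ʳ raise i u v h rewrite f-++ i u v | ≥⇒<ᵇ≡false (≮⇒≥ h) = refl
op-++ʳ lower i u v h rewrite e-++ i u v | <⇒<ᵇ≡true (≰⇒> h) = refl

map-just⁻¹ : ∀ {A B : Set} {g : A → B} m {y} → mapMaybe g m ≡ just y → ∃ λ x → m ≡ just x × y ≡ g x
map-just⁻¹ (just x) refl = x , refl , refl

op-++-just : ∀ o i u v {w} → op o i (u ++ v) ≡ just w →
  (ActsLeft o (φ i u) (ε i v) × ∃ λ u′ → op o i u ≡ just u′ × w ≡ u′ ++ v) ⊎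
  (¬ ActsLeft o (φ i u) (ε i v) × ∃ λ v′ → op o i v ≡ just v′ × w ≡ u ++ v′)
op-++-just o i u v h with actsLeft? o (φ i u) (ε i v)
... | yes l = inj₁ (l , map-just⁻¹ (op o i u) (trans (sym (op-++ˡ o i u v l)) h))
... | no r  = inj₂ (r , map-just⁻¹ (op o i v) (trans (sym (op-++ʳ o i u v r)) h))

op-[] : ∀ o i → op o i [] ≡ nothing
op-[] raise i = refl
op-[] lower i = refl

op-letter : ∀ o i x {w} → op o i (x ∷ []) ≡ just w → ∃ λ y → w ≡ y ∷ []
op-letter raise i x h with f-∷-just i x [] h
... | inj₁ (_ , y , _ , refl) = y , refl
op-letter lower i x h with e-∷-just i x [] h
... | inj₂ (_ , y , _ , refl) = y , refl

-- Components and highest weight vectors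

Conn-op : ∀ {u} o i {v w} → Conn u v → op o i v ≡ just w → Conn u w
Conn-op raise i = stepf i
Conn-op lower i = stepe i

Conn-closed : (R : Word → Set) → (∀ o i {v w} → R v → op o i v ≡ just w → R w) → ∀ {u w} → R u → Conn u w → R w
Conn-closed R step r here           = r
Conn-closed R step r (stepf i c eq) = step raise i (Conn-closed R step r c) eq
Conn-closed R step r (stepe i c eq) = step lower i (Conn-closed R step r c) eq

Conn-trans : ∀ {u v w} → Conn u v → Conn v w → Conn u w
Conn-trans {u} = Conn-closed (Conn u) Conn-op

Conn-sym : ∀ {u v} → Conn u v → Conn v u
Conn-sym here           = here
Conn-sym (stepf i q eq) = Conn-trans (stepe i here (f⇒e i _ eq)) (Conn-sym q)
Conn-sym (stepe i q eq) = Conn-trans (stepf i here (e⇒f i _ eq)) (Conn-sym q)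

Conn-[] : ∀ {w} → Conn [] w → w ≡ []
Conn-[] = Conn-closed (_≡ []) (λ { o i refl eq → ⊥-elim (nothing≢just (trans (sym (op-[] o i)) eq)) }) refl
  where
  nothing≢just : ∀ {w : Word} → nothing ≢ just w
  nothing≢just ()

op-∷ʳ : ∀ o i u b {w} → op o i (u ∷ʳ b) ≡ just w →
  (∃ λ u′ → op o i u ≡ just u′ × w ≡ u′ ∷ʳ b) ⊎ (∃ λ c → w ≡ u ∷ʳ c)
op-∷ʳ o i u b h with op-++-just o i u (b ∷ []) h
... | inj₁ (_ , u′ , ou , refl) = inj₁ (u′ , ou , refl)
... | inj₂ (_ , _ , ob , refl) with op-letter o i b ob
...   | c , refl = inj₂ (c , refl)

ExtendsComponent : Word → Word → Set
ExtendsComponent u w = ∃₂ λ u′ b → w ≡ u′ ∷ʳ b × Conn u u′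

Conn-∷ʳ : ∀ {u a w} → Conn (u ∷ʳ a) w → ExtendsComponent u w
Conn-∷ʳ {u} = Conn-closed (ExtendsComponent u) step (_ , _ , refl , here)
  where
  step : ∀ o i {v w} → ExtendsComponent u v → op o i v ≡ just w → ExtendsComponent u w
  step o i (u′ , b , refl , cu) eq with op-∷ʳ o i u′ b eq
  ... | inj₁ (u″ , ou , refl) = u″ , b , refl , Conn-op o i cu ou
  ... | inj₂ (c , refl)       = u′ , c , refl , cu

Highest : Word → Set
Highest w = ∀ i → ε i w ≡ 0

highest-or-lowerable : ∀ w → Highest w ⊎ ∃₂ λ i w′ → e i w ≡ just w′
highest-or-lowerable w with e i1 w in e₁ | e i2 w in e₂
... | just w′ | _       = inj₂ (i1 , w′ , e₁)
... | nothing | just w′ = inj₂ (i2 , w′ , e₂)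
... | nothing | nothing = inj₁ highest
  where
  highest : Highest w
  highest i1 = e≡nothing⇒ε≡0 i1 w e₁
  highest i2 = e≡nothing⇒ε≡0 i2 w e₂

highest-reachable-< : ∀ n w → rankSum w < n → ∃ λ h → Conn w h × Highest h
highest-reachable-< (suc n) w (s≤s r) with highest-or-lowerable w
... | inj₁ highest = w , here , highest
... | inj₂ (i , w′ , eq) with highest-reachable-< n w′ (subst (_≤ n) (e-rankSum i w eq) r)
...   | h , c , hh = h , Conn-trans (stepe i here eq) c , hh

highest-reachable : ∀ w → ∃ λ h → Conn w h × Highest h
highest-reachable w = highest-reachable-< (suc (rankSum w)) w ≤-refl

Highest-++ˡ : ∀ u v → Highest (u ++ v) → Highest u
Highest-++ˡ u v h i = m+n≡0⇒m≡0 (ε i u) (trans (sym (ε-++ i u v)) (h i))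

Highest-++-≤ : ∀ u v → Highest (u ++ v) → ∀ i → ε i v ≤ φ i u
Highest-++-≤ u v h i = m∸n≡0⇒m≤n (m+n≡0⇒n≡0 (ε i u) (trans (sym (ε-++ i u v)) (h i)))

φ₁₂ : Word → Shape
φ₁₂ w = φ i1 w , φ i2 w

φ-++-highest : ∀ i u v → ε i v ≤ φ i u → φ i (u ++ v) + ε i v ≡ φ i v + φ i u
φ-++-highest i u v le = begin
  φ i (u ++ v) + ε i v              ≡⟨ cong (_+ ε i v) (φ-++ i u v) ⟩
  (φ i v + (φ i u ∸ ε i v)) + ε i v ≡⟨ +-assoc (φ i v) _ _ ⟩
  φ i v + ((φ i u ∸ ε i v) + ε i v) ≡⟨ cong (φ i v +_) (m∸n+n≡m le) ⟩
  φ i v + φ i u                     ∎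
  where open ≡-Reasoning

ε-letter : ∀ i x → ε i (x ∷ []) ≡ εL i x
ε-letter i x = trans (cong (εL i x +_) (0∸n≡0 (φL i x))) (+-identityʳ (εL i x))

+-cancel-cross : ∀ a b c d e f → a + b ≡ c + e → a + d ≡ f + e → b + f ≡ d + c
+-cancel-cross a b c d e f p q = +-cancelˡ-≡ a _ _ (begin
  a + (b + f)  ≡⟨ +-assoc a b f ⟨
  (a + b) + f  ≡⟨ cong (_+ f) p ⟩
  (c + e) + f  ≡⟨ +-comm (c + e) f ⟩
  f + (c + e)  ≡⟨ cong (f +_) (+-comm c e) ⟩
  f + (e + c)  ≡⟨ +-assoc f e c ⟨
  (f + e) + c  ≡⟨ cong (_+ c) q ⟨
  (a + d) + c  ≡⟨ +-assoc a d c ⟩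
  a + (d + c)  ∎)
  where open ≡-Reasoning

last-letter-unique : ∀ h x y → Highest (h ∷ʳ x) → Highest (h ∷ʳ y) → φ₁₂ (h ∷ʳ x) ≡ φ₁₂ (h ∷ʳ y) → x ≡ y
last-letter-unique h x y hx hy eq = weight-injective x y λ i →
  +-cancel-cross (φ i (h ∷ʳ x)) (εL i x) (φL i x) (εL i y) (φ i h) (φL i y)
    (subst (λ n → φ i (h ∷ʳ x) + n ≡ φL i x + φ i h) (ε-letter i x)
      (φ-++-highest i h (x ∷ []) (Highest-++-≤ h (x ∷ []) hx i)))
    (subst₂ (λ m n → m + n ≡ φL i y + φ i h) (sym (φ-≡ i)) (ε-letter i y)
      (φ-++-highest i h (y ∷ []) (Highest-++-≤ h (y ∷ []) hy i)))
  where
  φ-≡ : ∀ i → φ i (h ∷ʳ x) ≡ φ i (h ∷ʳ y)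
  φ-≡ i1 = cong proj₁ eq
  φ-≡ i2 = cong proj₂ eq

-- Tableau words

rw : List Col → Word
rw []       = []
rw (C ∷ cs) = rw cs ++ wC C

wT≡rw : ∀ T → wT T ≡ rw (Tableau.cols T)
wT≡rw T = go (Tableau.cols T)
  where
  go : ∀ cs → concatMap wC (reverse cs) ≡ rw cs
  go []       = refl
  go (C ∷ cs) = begin
    concatMap wC (reverse (C ∷ cs))        ≡⟨ cong (concatMap wC) (unfold-reverse C cs) ⟩
    concatMap wC (reverse cs ∷ʳ C)         ≡⟨ concatMap-++ wC (reverse cs) (C ∷ []) ⟩
    concatMap wC (reverse cs) ++ wC C ++ [] ≡⟨ cong₂ _++_ (go cs) (++-identityʳ (wC C)) ⟩
    rw cs ++ wC C                          ∎
    where open ≡-Reasoning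

column : ℕ → Word → Maybe Col
column 1 (a ∷ [])     = just (col1 a)
column 2 (a ∷ b ∷ []) = just (col2 a b)
column _ _            = nothing

columnPair : ℕ → ℕ → Word → Maybe (Col × Col)
columnPair 1 h (a ∷ w)     = mapMaybe (col1 a ,_) (column h w)
columnPair 2 h (a ∷ b ∷ w) = mapMaybe (col2 a b ,_) (column h w)
columnPair _ _ _           = nothing

columnPair-wC : ∀ D C → columnPair (height D) (height C) (wC D ++ wC C) ≡ just (D , C)
columnPair-wC (col1 _)   (col1 _)   = refl
columnPair-wC (col1 _)   (col2 _ _) = refl
columnPair-wC (col2 _ _) (col1 _)   = refl
columnPair-wC (col2 _ _) (col2 _ _) = refl

AdmissibleColumnReading : ℕ → Word → Set
AdmissibleColumnReading h w = ∃ λ C → wC C ≡ w × height C ≡ h × Admissible C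

opaque
  column-closed : ∀ o i C → Admissible C → MaybeAll.All (AdmissibleColumnReading (height C)) (op o i (wC C))
  column-closed = from-yes (∀Op? λ o → ∀I? λ i → ∀Col? λ C → admissible? C →-dec
    MaybeAll.dec (λ w → ∃Col? λ C′ → (wC C′ ≟W w) ×-dec (height C′ ≟ height C) ×-dec admissible? C′) (op o i (wC C)))
    where
    _≟W_ : DecidableEquality Word
    _≟W_ = List.≡-dec _≟G_

  pair-closed : ∀ o i D C → Admissible D → Admissible C → C ⪯C D →
    MaybeAll.All (λ w → MaybeAny.Any (λ (D′ , C′) → C′ ⪯C D′) (columnPair (height D) (height C) w)) (op o i (wC D ++ wC C))
  pair-closed = from-yes (∀Op? λ o → ∀I? λ i → ∀Col? λ D → ∀Col? λ C →
    admissible? D →-dec admissible? C →-dec ⪯C? C D →-dec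
    MaybeAll.dec (λ w → MaybeAny.dec (λ (D′ , C′) → ⪯C? C′ D′) (columnPair (height D) (height C) w)) (op o i (wC D ++ wC C)))

op-column : ∀ o i C {w} → Admissible C → op o i (wC C) ≡ just w → AdmissibleColumnReading (height C) w
op-column o i C aC eq = MaybeAll.drop-just (subst (MaybeAll.All _) eq (column-closed o i C aC))

op-pair : ∀ o i {D C D′ C′} → Admissible D → Admissible C → C ⪯C D →
  op o i (wC D ++ wC C) ≡ just (wC D′ ++ wC C′) → height D′ ≡ height D → height C′ ≡ height C → C′ ⪯C D′
op-pair o i {D} {C} {D′} {C′} aD aC C⪯D eq hD hC =
  MaybeAny.drop-just (subst (MaybeAny.Any _) (columnPair-wC D′ C′)
    (subst₂ (λ h h′ → MaybeAny.Any _ (columnPair h h′ (wC D′ ++ wC C′))) (sym hD) (sym hC)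
      (MaybeAll.drop-just (subst (MaybeAll.All _) eq (pair-closed o i D C aD aC C⪯D)))))

φ-head≤ : ∀ i C cs → φ i (wC C) ≤ φ i (rw (C ∷ cs))
φ-head≤ i C cs = subst (φ i (wC C) ≤_) (sym (φ-++ i (rw cs) (wC C))) (m≤m+n _ _)

φ-head≡ : ∀ i C cs → φ i (rw cs) ≤ ε i (wC C) → φ i (rw (C ∷ cs)) ≡ φ i (wC C)
φ-head≡ i C cs le = trans (φ-++ i (rw cs) (wC C)) (trans (cong (φ i (wC C) +_) (m≤n⇒m∸n≡0 le)) (+-identityʳ _))

-- The φ-equation transfers the tensor-rule condition from the whole reading to its first column.
HeadStep : Op → I → Col → List Col → Col → Set
HeadStep o i C cs C′ = C′ ≡ C ⊎ (op o i (wC C) ≡ just (wC C′) × φ i (rw (C ∷ cs)) ≡ φ i (wC C))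

record ColumnsImage (o : Op) (i : I) (C : Col) (cs : List Col) (w : Word) : Set where
  constructor image
  field
    head′      : Col
    tail′      : List Col
    reading    : rw (head′ ∷ tail′) ≡ w
    heights    : map height (head′ ∷ tail′) ≡ map height (C ∷ cs)
    admissible : All Admissible (head′ ∷ tail′)
    linked     : Linked _⪯C_ (head′ ∷ tail′)
    head-step  : HeadStep o i C cs head′

relink-head : ∀ o i C C′ cs → All Admissible cs → Admissible C → Linked _⪯C_ (C ∷ cs) →
  ¬ ActsLeft o (φ i (rw cs)) (ε i (wC C)) → op o i (wC C) ≡ just (wC C′) → height C′ ≡ height C → Linked _⪯C_ (C′ ∷ cs)
relink-head o i C C′ []      _         _  _            _     _  _  = [-]
relink-head o i C C′ (D ∷ r) (aD ∷ _) aC (C⪯D ∷ lk) right oC hC = op-pair o i aD aC C⪯D oDC refl hC ∷ lk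
  where
  oDC : op o i (wC D ++ wC C) ≡ just (wC D ++ wC C′)
  oDC = trans (op-++ʳ o i (wC D) (wC C) (λ l → right (ActsLeft-mono o (φ-head≤ i D r) l))) (cong (mapMaybe (wC D ++_)) oC)

relink-tail : ∀ o i C D r D′ → Admissible C → Admissible D → C ⪯C D →
  ActsLeft o (φ i (rw (D ∷ r))) (ε i (wC C)) → HeadStep o i D r D′ → height D′ ≡ height D → C ⪯C D′
relink-tail o i C D r .D _  _  C⪯D _    (inj₁ refl)       _  = C⪯D
relink-tail o i C D r D′ aC aD C⪯D left (inj₂ (oD , φD)) hD = op-pair o i aD aC C⪯D oDC hD refl
  where
  oDC : op o i (wC D ++ wC C) ≡ just (wC D′ ++ wC C)
  oDC = trans (op-++ˡ o i (wC D) (wC C) (subst (λ p → ActsLeft o p _) φD left)) (cong (mapMaybe (_++ wC C)) oD)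

op-columns : ∀ o i C cs {w} → All Admissible (C ∷ cs) → Linked _⪯C_ (C ∷ cs) →
  op o i (rw (C ∷ cs)) ≡ just w → ColumnsImage o i C cs w
op-columns o i C cs (aC ∷ aR) lk eq with op-++-just o i (rw cs) (wC C) eq
op-columns o i C [] _ _ _ | inj₁ (_ , _ , o[] , _) with () ← trans (sym (op-[] o i)) o[]
op-columns o i C (D ∷ r) (aC ∷ aR) (C⪯D ∷ lk) _ | inj₁ (left , _ , oR , refl) with op-columns o i D r aR lk oR
... | image D′ r′ refl hs aR′ lk′ step =
  image C (D′ ∷ r′) refl (cong (height C ∷_) hs) (aC ∷ aR′)
    (relink-tail o i C D r D′ aC (All.head aR) C⪯D left step (proj₁ (∷-injective hs)) ∷ lk′) (inj₁ refl)
op-columns o i C cs (aC ∷ aR) lk _ | inj₂ (right , _ , oC , refl) with op-column o i C aC oC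
... | C′ , refl , hC , aC′ =
  image C′ cs refl (cong (_∷ map height cs) hC) (aC′ ∷ aR) (relink-head o i C C′ cs aR aC lk right oC hC)
    (inj₂ (oC , φ-head≡ i C cs (¬ActsLeft⇒≤ o right)))

TableauWord : Shape → Word → Set
TableauWord sh w = Σ (List Col) λ cs → IsTableau sh cs × rw cs ≡ w

TableauWord-op : ∀ {sh} o i {v w} → TableauWord sh v → op o i v ≡ just w → TableauWord sh w
TableauWord-op o i ([] , _ , refl) eq with () ← trans (sym (op-[] o i)) eq
TableauWord-op o i (C ∷ cs , (fills , adm , lk) , refl) eq with op-columns o i C cs adm lk eq
... | image C′ cs′ reading heights adm′ lk′ _ = C′ ∷ cs′ , (trans heights fills , adm′ , lk′) , reading

TableauWord-Conn : ∀ {sh v w} → TableauWord sh v → Conn v w → TableauWord sh w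
TableauWord-Conn {sh} = Conn-closed (TableauWord sh) (TableauWord-op {sh})

-- Highest weight tableaux

data Canonical : Col → Set where
  canonical₁ : Canonical (col1 g1)
  canonical₂ : Canonical (col2 g1 g2)

canonical? : ∀ C → Dec (Canonical C)
canonical? (col1 a) with a ≟G g1
... | yes refl = yes canonical₁
... | no a≢1   = no λ { canonical₁ → a≢1 refl }
canonical? (col2 a b) with a ≟G g1 | b ≟G g2
... | yes refl | yes refl = yes canonical₂
... | no a≢1   | _        = no λ { canonical₂ → a≢1 refl }
... | _        | no b≢2   = no λ { canonical₂ → b≢2 refl }

canonicalColumns : Shape → List Col
canonicalColumns (l1 , l2) = replicate l2 (col2 g1 g2) ++ replicate l1 (col1 g1)

opaque
  highest-column-canonical : ∀ C → Admissible C → Highest (wC C) → Canonical C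
  highest-column-canonical = from-yes (∀Col? λ C → admissible? C →-dec ∀I? (λ i → ε i (wC C) ≟ 0) →-dec canonical? C)

  canonical-before-[1,2] : ∀ C → Admissible C → C ⪯C col2 g1 g2 → Canonical C
  canonical-before-[1,2] = from-yes (∀Col? λ C → admissible? C →-dec ⪯C? C (col2 g1 g2) →-dec canonical? C)

  canonical-before-[1] : ∀ C → Admissible C → C ⪯C col1 g1 → ε i2 (wC C) ≡ 0 → Canonical C
  canonical-before-[1] = from-yes (∀Col? λ C → admissible? C →-dec ⪯C? C (col1 g1) →-dec (ε i2 (wC C) ≟ 0) →-dec canonical? C)

φ-rw-canonical : ∀ i {C} → Canonical C → ∀ cs → φ i (rw (C ∷ cs)) ≡ φ i (wC C) + φ i (rw cs)
φ-rw-canonical i {C} can cs = trans (φ-++ i (rw cs) (wC C)) (cong (λ n → φ i (wC C) + (φ i (rw cs) ∸ n)) (ε-canonical i can))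
  where
  ε-canonical : ∀ i {C} → Canonical C → ε i (wC C) ≡ 0
  ε-canonical i1 canonical₁ = refl
  ε-canonical i2 canonical₁ = refl
  ε-canonical i1 canonical₂ = refl
  ε-canonical i2 canonical₂ = refl

φ₂-after-[1] : ∀ cs → All Canonical cs → Linked _⪯C_ (col1 g1 ∷ cs) → φ i2 (rw cs) ≡ 0
φ₂-after-[1] []                  _                 _        = refl
φ₂-after-[1] (col1 _ ∷ cs)       (canonical₁ ∷ cc) (_ ∷ lk) = trans (φ-rw-canonical i2 canonical₁ cs) (φ₂-after-[1] cs cc lk)
φ₂-after-[1] (col2 _ _ ∷ _)      _                 (() ∷ _)

canonical-head : ∀ C cs → Admissible C → Linked _⪯C_ (C ∷ cs) → All Canonical cs →
  (∀ i → ε i (wC C) ≤ φ i (rw cs)) → Canonical C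
canonical-head C []              aC _          _                 le = highest-column-canonical C aC (λ i → n≤0⇒n≡0 (le i))
canonical-head C (col1 _ ∷ r)    aC (C⪯ ∷ lk) (canonical₁ ∷ cr) le =
  canonical-before-[1] C aC C⪯
    (n≤0⇒n≡0 (subst (ε i2 (wC C) ≤_) (trans (φ-rw-canonical i2 canonical₁ r) (φ₂-after-[1] r cr lk)) (le i2)))
canonical-head C (col2 _ _ ∷ r)  aC (C⪯ ∷ _)  (canonical₂ ∷ _)  _  = canonical-before-[1,2] C aC C⪯

highest-canonical : ∀ cs → All Admissible cs → Linked _⪯C_ cs → Highest (rw cs) → All Canonical cs
highest-canonical []       _         _  _ = []
highest-canonical (C ∷ cs) (aC ∷ aR) lk h = canonical-head C cs aC lk rest (Highest-++-≤ (rw cs) (wC C) h) ∷ rest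
  where
  rest : All Canonical cs
  rest = highest-canonical cs aR (Linked.tail lk) (Highest-++ˡ (rw cs) (wC C) h)

canonical-shape : ∀ sh cs → All Canonical cs → FillsShape sh cs → cs ≡ canonicalColumns sh
canonical-shape (zero   , zero)   []             _                _  = refl
canonical-shape (suc l1 , zero)   (col1 _ ∷ cs)   (canonical₁ ∷ cc) eq =
  cong (col1 g1 ∷_) (canonical-shape (l1 , zero) cs cc (proj₂ (∷-injective eq)))
canonical-shape (l1     , suc l2) (col2 _ _ ∷ cs) (canonical₂ ∷ cc) eq =
  cong (col2 g1 g2 ∷_) (canonical-shape (l1 , l2) cs cc (proj₂ (∷-injective eq)))
canonical-shape (zero   , zero)   (_ ∷ _)         _                ()
canonical-shape (suc _  , zero)   []              _                ()
canonical-shape (suc _  , zero)   (col2 _ _ ∷ _)  _                ()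
canonical-shape (_      , suc _)  []              _                ()
canonical-shape (_      , suc _)  (col1 _ ∷ _)    _                ()

highest-TableauWord : ∀ {sh w} → TableauWord sh w → Highest w → w ≡ rw (canonicalColumns sh)
highest-TableauWord {sh} (cs , (fills , adm , lk) , refl) h = cong rw (canonical-shape sh cs (highest-canonical cs adm lk h) fills)

φ₁₂-rw-canonical : ∀ {C} → Canonical C → ∀ cs →
  φ₁₂ (rw (C ∷ cs)) ≡ (φ i1 (wC C) + φ i1 (rw cs) , φ i2 (wC C) + φ i2 (rw cs))
φ₁₂-rw-canonical can cs = cong₂ _,_ (φ-rw-canonical i1 can cs) (φ-rw-canonical i2 can cs)

φ₁₂-canonical : ∀ sh → φ₁₂ (rw (canonicalColumns sh)) ≡ sh
φ₁₂-canonical (zero , zero)   = refl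
φ₁₂-canonical (suc l1 , zero) =
  trans (φ₁₂-rw-canonical canonical₁ (canonicalColumns (l1 , zero))) (cong (λ (a , b) → suc a , b) (φ₁₂-canonical (l1 , zero)))
φ₁₂-canonical (l1 , suc l2)   =
  trans (φ₁₂-rw-canonical canonical₂ (canonicalColumns (l1 , l2))) (cong (λ (a , b) → a , suc b) (φ₁₂-canonical (l1 , l2)))

-- Recording tableaux

prefixes-∷ʳ : ∀ u a → prefixes (u ∷ʳ a) ≡ prefixes u ∷ʳ (u ∷ʳ a)
prefixes-∷ʳ []      a = refl
prefixes-∷ʳ (x ∷ u) a = cong ((x ∷ []) ∷_)
  (trans (cong (map (x ∷_)) (prefixes-∷ʳ u a)) (map-++ (x ∷_) (prefixes u) ((u ∷ʳ a) ∷ [])))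

[]≢∷ʳ : ∀ {A : Set} (xs : List A) x → [] ≢ xs ∷ʳ x
[]≢∷ʳ []      _ ()
[]≢∷ʳ (_ ∷ _) _ ()

module _ (P : Word → Tableau) (isP : IsPFunction P) where

  shape : Word → Shape
  shape w = Tableau.shape (P w)

  Q-∷ʳ : ∀ u a → Q P (u ∷ʳ a) ≡ Q P u ∷ʳ shape (u ∷ʳ a)
  Q-∷ʳ u a = trans (cong (map shape) (prefixes-∷ʳ u a)) (map-++ shape (prefixes u) ((u ∷ʳ a) ∷ []))

  ψ-highest : ∀ {w h} → Conn w h → Highest h → CrystalIso.ψ (isP w) h ≡ rw (canonicalColumns (shape w))
  ψ-highest {w} {h} c hh = highest-TableauWord {shape w} (TableauWord-Conn {shape w} tableau (ψ-into h c)) (λ i → trans (ψ-ε h c i) (hh i))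
    where
    open CrystalIso (isP w)
    tableau : TableauWord (shape w) (wT (P w))
    tableau = Tableau.cols (P w) , Tableau.isTab (P w) , sym (wT≡rw (P w))

  shape-highest : ∀ {w h} → Conn w h → Highest h → shape w ≡ φ₁₂ h
  shape-highest {w} {h} c hh = begin
    shape w                                 ≡⟨ φ₁₂-canonical (shape w) ⟨
    φ₁₂ (rw (canonicalColumns (shape w)))  ≡⟨ cong φ₁₂ (ψ-highest c hh) ⟨
    φ₁₂ (ψ h)                              ≡⟨ cong₂ _,_ (ψ-φ h c i1) (ψ-φ h c i2) ⟩
    φ₁₂ h                                  ∎
    where
    open CrystalIso (isP w)
    open ≡-Reasoning

  highest-unique : ∀ {w h h′} → Conn w h → Conn w h′ → Highest h → Highest h′ → h ≡ h′
  highest-unique {w} {h} {h′} c c′ hh hh′ =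
    CrystalIso.ψ-inj (isP w) h h′ c c′ (trans (ψ-highest c hh) (sym (ψ-highest c′ hh′)))

  Conn⇒shape≡ : ∀ {w w′} → Conn w w′ → shape w ≡ shape w′
  Conn⇒shape≡ {w} c with highest-reachable w
  ... | h , ch , hh = trans (shape-highest ch hh) (sym (shape-highest (Conn-trans (Conn-sym c) ch) hh))

  Conn-∷ʳ-shape : ∀ {u u′} a b → Conn u u′ → shape (u ∷ʳ a) ≡ shape (u′ ∷ʳ b) → Conn (u ∷ʳ a) (u′ ∷ʳ b)
  Conn-∷ʳ-shape {u} {u′} a b cu eq with highest-reachable (u ∷ʳ a) | highest-reachable (u′ ∷ʳ b)
  ... | _ , cH , hH | _ , cH′ , hH′ with Conn-∷ʳ cH | Conn-∷ʳ cH′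
  ...   | h , x , refl , ch | h′ , y , refl , ch′
          with refl ← highest-unique ch (Conn-trans cu ch′) (Highest-++ˡ h (x ∷ []) hH) (Highest-++ˡ h′ (y ∷ []) hH′)
          with refl ← last-letter-unique h x y hH hH′ (trans (sym (shape-highest cH hH)) (trans eq (shape-highest cH′ hH′)))
          = Conn-trans cH (Conn-sym cH′)

  Conn⇒Q≡ : ∀ {w₁ w₂} → Reverse w₁ → Conn w₁ w₂ → Q P w₁ ≡ Q P w₂
  Conn⇒Q≡ [] c rewrite Conn-[] c = refl
  Conn⇒Q≡ (u ∶ ru ∶ʳ a) c with Conn-∷ʳ c
  ... | u′ , b , refl , cu = begin
    Q P (u ∷ʳ a)             ≡⟨ Q-∷ʳ u a ⟩
    Q P u ∷ʳ shape (u ∷ʳ a)  ≡⟨ cong₂ _∷ʳ_ (Conn⇒Q≡ ru cu) (Conn⇒shape≡ c) ⟩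
    Q P u′ ∷ʳ shape (u′ ∷ʳ b) ≡⟨ Q-∷ʳ u′ b ⟨
    Q P (u′ ∷ʳ b)            ∎
    where open ≡-Reasoning

  Q≡⇒Conn : ∀ {w₁ w₂} → Reverse w₁ → Reverse w₂ → Q P w₁ ≡ Q P w₂ → Conn w₁ w₂
  Q≡⇒Conn []             []               _  = here
  Q≡⇒Conn []             (u₂ ∶ _ ∶ʳ a₂)   eq = ⊥-elim ([]≢∷ʳ (Q P u₂) _ (trans eq (Q-∷ʳ u₂ a₂)))
  Q≡⇒Conn (u₁ ∶ _ ∶ʳ a₁) []               eq = ⊥-elim ([]≢∷ʳ (Q P u₁) _ (trans (sym eq) (Q-∷ʳ u₁ a₁)))
  Q≡⇒Conn (u₁ ∶ r₁ ∶ʳ a₁) (u₂ ∶ r₂ ∶ʳ a₂) eq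
    with eqQ , eqShape ← ∷ʳ-injective (Q P u₁) (Q P u₂) (trans (sym (Q-∷ʳ u₁ a₁)) (trans eq (Q-∷ʳ u₂ a₂)))
    = Conn-∷ʳ-shape a₁ a₂ (Q≡⇒Conn r₁ r₂ eqQ) eqShape

theorem3p3p3 : (P : Word → Tableau) → IsPFunction P →
    (w₁ w₂ : Word) → (Conn w₁ w₂ → Q P w₁ ≡ Q P w₂) × (Q P w₁ ≡ Q P w₂ → Conn w₁ w₂)
theorem3p3p3 P isP w₁ w₂ = Conn⇒Q≡ P isP (reverseView w₁) , Q≡⇒Conn P isP (reverseView w₁) (reverseView w₂)
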